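{- Let $q=2^h$ and let $\mathcal{H}$ be a hyperfocused $k$-arc in $\mathrm{PG}(2,q)$ with focus line $\ell$. Let $\mathcal{F}$ be the associated 1-factorization of the complete graph on the vertex set $\mathcal{H}$: for each point $P$ of the focus set, the 1-factor corresponding to $P$ consists of all pairs $\{X,Y\}\subseteq\mathcal{H}$ whose secant line $XY$ passes through $P$. Suppose $A,B,C,D,E,F,G,H$ are eight distinct points of $\mathcal{H}$ such that each of the following five pairs of edges lies in a common 1-factor of $\mathcal{F}$: $\{AB,EF\}$, $\{AC,EG\}$, $\{BC,FG\}$, $\{BD,FH\}$, $\{CD,GH\}$ (different pairs may or may not share a 1-factor). Then the edges $AD$ and $EH$ lie in the same 1-factor of $\mathcal{F}$; equivalently, the lines $AD$ and $EH$ meet at a point of $\ell$.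
   Context: A $k$-arc in $\mathrm{PG}(2,q)$ is a set of $k$ points no three collinear. A $k$-arc $\mathcal{K}$ is hyperfocused on a line $\ell$ disjoint from $\mathcal{K}$ if the $\binom{k}{2}$ secant lines of $\mathcal{K}$ meet $\ell$ in exactly $k-1$ points; $\ell$ is the focus line and these $k-1$ points form the focus set. The secants through a single focus point partition $\mathcal{K}$ into pairs, so the focus set yields a 1-factorization of the complete graph $K_k$ on vertex set $\mathcal{K}$ (edges = pairs of points of $\mathcal{K}$). -}

module Defs where

open import Level using (Level; _⊔_)
open import Algebra.Bundles using (CommutativeRing)
open import Data.Nat using (ℕ; _∸_; _^_)
open import Data.Fin using (Fin)
open import Data.Product using (Σ; ∃; _×_; _,_)
open import Relation.Nullary using (¬_)
open import Relation.Binary.PropositionalEquality using (_≡_)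

record IsFiniteFieldOfOrder {c ℓ : Level} (R : CommutativeRing c ℓ) (q : ℕ) : Set (c ⊔ ℓ) where
  open CommutativeRing R
  field
    0≉1       : ¬ (0# ≈ 1#)
    inverse   : ∀ x → ¬ (x ≈ 0#) → Σ Carrier (λ y → (x * y) ≈ 1#)
    enum      : Fin q → Carrier
    enum-inj  : ∀ i j → enum i ≈ enum j → i ≡ j
    enum-surj : ∀ x → Σ (Fin q) (λ i → enum i ≈ x)

module Projective {c ℓ : Level} (R : CommutativeRing c ℓ) where
  open CommutativeRing R

  Vec3 : Set c
  Vec3 = Carrier × Carrier × Carrier

  IsZero3 : Vec3 → Set ℓ
  IsZero3 (x , y , z) = (x ≈ 0#) × (y ≈ 0#) × (z ≈ 0#)

  -- points of PG(2,F): nonzero triples (taken up to nonzero scalars, see SamePoint)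
  Point : Set (c ⊔ ℓ)
  Point = Σ Vec3 (λ v → ¬ IsZero3 v)

  Line : Set (c ⊔ ℓ)
  Line = Σ Vec3 (λ v → ¬ IsZero3 v)

  coords : Point → Vec3
  coords (v , _) = v

  SamePoint : Point → Point → Set (c ⊔ ℓ)
  SamePoint ((x₁ , y₁ , z₁) , _) ((x₂ , y₂ , z₂) , _) =
    Σ Carrier (λ t → ¬ (t ≈ 0#) × (x₁ ≈ (t * x₂)) × (y₁ ≈ (t * y₂)) × (z₁ ≈ (t * z₂)))

  OnLine : Point → Line → Set ℓ
  OnLine ((x , y , z) , _) ((a , b , c') , _) = ((a * x) + (b * y) + (c' * z)) ≈ 0#

  det3 : Vec3 → Vec3 → Vec3 → Carrier
  det3 (a₁ , a₂ , a₃) (b₁ , b₂ , b₃) (c₁ , c₂ , c₃) =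
      (a₁ * ((b₂ * c₃) - (b₃ * c₂)))
    - (a₂ * ((b₁ * c₃) - (b₃ * c₁)))
    + (a₃ * ((b₁ * c₂) - (b₂ * c₁)))

  Collinear : Point → Point → Point → Set ℓ
  Collinear P Q S = det3 (coords P) (coords Q) (coords S) ≈ 0#

  record IsArc (k : ℕ) (K : Fin k → Point) : Set (c ⊔ ℓ) where
    field
      distinct     : ∀ i j → ¬ (i ≡ j) → ¬ SamePoint (K i) (K j)
      noThreeColl  : ∀ i j l → ¬ (i ≡ j) → ¬ (i ≡ l) → ¬ (j ≡ l) →
                     ¬ Collinear (K i) (K j) (K l)

  SecantMeet : (k : ℕ) → (Fin k → Point) → Line → Fin k → Fin k → Point → Set ℓ
  SecantMeet k K L i j P = OnLine P L × Collinear P (K i) (K j)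

  -- a k-arc K hyperfocused on L: L is disjoint from K, and the set of points
  -- where the secants of K meet L has exactly k - 1 elements (it is the image
  -- of an injective family  focus : Fin (k ∸ 1) → Point).
  record IsHyperfocused (k : ℕ) (K : Fin k → Point) (L : Line) : Set (c ⊔ ℓ) where
    field
      arc          : IsArc k K
      disjoint     : ∀ i → ¬ OnLine (K i) L
      focus        : Fin (k ∸ 1) → Point
      focus-inj    : ∀ m n → SamePoint (focus m) (focus n) → m ≡ n
      focus-onSec  : ∀ m → Σ (Fin k) (λ i → Σ (Fin k) (λ j →
                       ¬ (i ≡ j) × SecantMeet k K L i j (focus m)))
      focus-cover  : ∀ i j → ¬ (i ≡ j) → ∀ P → SecantMeet k K L i j P →
                       Σ (Fin (k ∸ 1)) (λ m → SamePoint P (focus m))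

  -- edges {K i, K j} and {K i', K j'} lie in the same 1-factor of the associated
  -- 1-factorization: the secants K i K j and K i' K j' pass through a common
  -- point of the focus line L (necessarily a focus point).
  SameFactor : (k : ℕ) → (Fin k → Point) → Line → Fin k → Fin k → Fin k → Fin k → Set (c ⊔ ℓ)
  SameFactor k K L i j i' j' =
    Σ Point (λ P → OnLine P L × Collinear P (K i) (K j) × Collinear P (K i') (K j'))

{-# OPTIONS --safe #-}

-- Scaling every point off the focus line ℓ so that ℓ · x = 1 identifies PG(2,q) ∖ ℓ with an
-- affine plane, in which two secants meet on ℓ exactly when their difference vectors u, v are
-- parallel, i.e. det(u, v, N) = 0 for any affine point N. The hypotheses then say that the
-- triangles ABC, EFG and BCD, FGH have parallel sides, so the dilation B ↦ F, C ↦ G maps A to E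
-- and D to H, whence AD ∥ EH. Algebraically, three Plücker relations and the five hypotheses
-- give det(AB, AC) · det(BC, BD) · det(AD, EH) = 0, and the first two factors do not vanish since
-- no three points of the arc are collinear.

module Submission where

open import Defs
open import Level using (Level)
open import Algebra.Bundles using (CommutativeRing)
open import Algebra.Solver.Ring.AlmostCommutativeRing using (fromCommutativeRing; _-Raw-AlmostCommutative⟶_)
open import Data.Nat as ℕ using (ℕ; zero; suc; _^_)
import Data.Nat.Properties as ℕ
open import Data.Integer as ℤ using (ℤ; +_; -[1+_])
import Data.Integer.Properties as ℤ
open import Data.Fin using (Fin; #_)
import Data.Fin.Properties as Fin
import Data.Maybe as Maybe
open import Data.Product using (Σ; _×_; _,_; proj₁; proj₂)
open import Data.Empty using (⊥-elim)
open import Function using (_∘_)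
open import Function.Definitions using (Injective)
open import Relation.Nullary using (¬_; Dec; yes; no)
open import Relation.Binary.Consequences using (dec⇒weaklyDec)
open import Relation.Binary.PropositionalEquality as ≡ using (_≡_; _≢_)

-- The ring solver needs a coefficient ring with decidable equality mapping into R; ℤ is one.
module IntegerCoefficientSolver {c ℓ : Level} (R : CommutativeRing c ℓ) where
  open CommutativeRing R
  open import Algebra.Properties.Ring ring using (-0#≈0#; -‿involutive; -‿+-comm; -‿distribˡ-*; -‿distribʳ-*)
  open import Algebra.Properties.CommutativeSemigroup +-commutativeSemigroup using (interchange)
  open import Algebra.Properties.Semiring.Mult.TCOptimised semiring using (1+×; ×-homo-+; ×1-homo-*) renaming (_×_ to _×ₙ_)
  open import Relation.Binary.Reasoning.Setoid setoid

  ⟦_⟧ℤ : ℤ → Carrier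
  ⟦ + n ⟧ℤ = n ×ₙ 1#
  ⟦ -[1+ n ] ⟧ℤ = - (suc n ×ₙ 1#)

  -‿homo : ∀ i → ⟦ ℤ.- i ⟧ℤ ≈ - ⟦ i ⟧ℤ
  -‿homo (+ zero) = sym -0#≈0#
  -‿homo (+ suc n) = refl
  -‿homo -[1+ n ] = sym (-‿involutive _)

  x+a-[x+b]≈a-b : ∀ x a b → (x + a) - (x + b) ≈ a - b
  x+a-[x+b]≈a-b x a b = begin
    (x + a) - (x + b)       ≈⟨ +-congˡ (-‿+-comm x b) ⟨
    (x + a) + (- x + - b)   ≈⟨ interchange x a (- x) (- b) ⟩
    (x - x) + (a - b)       ≈⟨ +-congʳ (-‿inverseʳ x) ⟩
    0# + (a - b)            ≈⟨ +-identityˡ _ ⟩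
    a - b                   ∎

  ⊖-homo : ∀ m n → ⟦ m ℤ.⊖ n ⟧ℤ ≈ m ×ₙ 1# - n ×ₙ 1#
  ⊖-homo m zero = sym (trans (+-congˡ -0#≈0#) (+-identityʳ _))
  ⊖-homo zero (suc n) = sym (+-identityˡ _)
  ⊖-homo (suc m) (suc n) = begin
    ⟦ suc m ℤ.⊖ suc n ⟧ℤ              ≡⟨ ≡.cong ⟦_⟧ℤ (ℤ.[1+m]⊖[1+n]≡m⊖n m n) ⟩
    ⟦ m ℤ.⊖ n ⟧ℤ                      ≈⟨ ⊖-homo m n ⟩
    m ×ₙ 1# - n ×ₙ 1#                   ≈⟨ x+a-[x+b]≈a-b 1# _ _ ⟨
    (1# + m ×ₙ 1#) - (1# + n ×ₙ 1#)     ≈⟨ +-cong (1+× m 1#) (-‿cong (1+× n 1#)) ⟨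
    suc m ×ₙ 1# - suc n ×ₙ 1#           ∎

  +-homo : ∀ i j → ⟦ i ℤ.+ j ⟧ℤ ≈ ⟦ i ⟧ℤ + ⟦ j ⟧ℤ
  +-homo (+ m) (+ n) = ×-homo-+ 1# m n
  +-homo (+ m) -[1+ n ] = ⊖-homo m (suc n)
  +-homo -[1+ m ] (+ n) = trans (⊖-homo n (suc m)) (+-comm _ _)
  +-homo -[1+ m ] -[1+ n ] = begin
    - (suc (suc (m ℕ.+ n)) ×ₙ 1#)        ≡⟨ ≡.cong (λ k → - (suc k ×ₙ 1#)) (ℕ.+-suc m n) ⟨
    - ((suc m ℕ.+ suc n) ×ₙ 1#)          ≈⟨ -‿cong (×-homo-+ 1# (suc m) (suc n)) ⟩
    - (suc m ×ₙ 1# + suc n ×ₙ 1#)         ≈⟨ -‿+-comm _ _ ⟨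
    - (suc m ×ₙ 1#) + - (suc n ×ₙ 1#)     ∎

  *-homo-+ : ∀ m n → ⟦ + m ℤ.* + n ⟧ℤ ≈ ⟦ + m ⟧ℤ * ⟦ + n ⟧ℤ
  *-homo-+ m n = trans (reflexive (≡.cong ⟦_⟧ℤ (≡.sym (ℤ.pos-* m n)))) (×1-homo-* m n)

  *-homo-negˡ : ∀ i j → ⟦ i ℤ.* j ⟧ℤ ≈ ⟦ i ⟧ℤ * ⟦ j ⟧ℤ → ⟦ ℤ.- i ℤ.* j ⟧ℤ ≈ ⟦ ℤ.- i ⟧ℤ * ⟦ j ⟧ℤ
  *-homo-negˡ i j hom = begin
    ⟦ ℤ.- i ℤ.* j ⟧ℤ         ≡⟨ ≡.cong ⟦_⟧ℤ (ℤ.neg-distribˡ-* i j) ⟨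
    ⟦ ℤ.- (i ℤ.* j) ⟧ℤ       ≈⟨ -‿homo (i ℤ.* j) ⟩
    - ⟦ i ℤ.* j ⟧ℤ           ≈⟨ -‿cong hom ⟩
    - (⟦ i ⟧ℤ * ⟦ j ⟧ℤ)      ≈⟨ -‿distribˡ-* _ _ ⟩
    - ⟦ i ⟧ℤ * ⟦ j ⟧ℤ        ≈⟨ *-congʳ (-‿homo i) ⟨
    ⟦ ℤ.- i ⟧ℤ * ⟦ j ⟧ℤ      ∎

  *-homo-negʳ : ∀ i j → ⟦ i ℤ.* j ⟧ℤ ≈ ⟦ i ⟧ℤ * ⟦ j ⟧ℤ → ⟦ i ℤ.* ℤ.- j ⟧ℤ ≈ ⟦ i ⟧ℤ * ⟦ ℤ.- j ⟧ℤ
  *-homo-negʳ i j hom = begin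
    ⟦ i ℤ.* ℤ.- j ⟧ℤ         ≡⟨ ≡.cong ⟦_⟧ℤ (ℤ.neg-distribʳ-* i j) ⟨
    ⟦ ℤ.- (i ℤ.* j) ⟧ℤ       ≈⟨ -‿homo (i ℤ.* j) ⟩
    - ⟦ i ℤ.* j ⟧ℤ           ≈⟨ -‿cong hom ⟩
    - (⟦ i ⟧ℤ * ⟦ j ⟧ℤ)      ≈⟨ -‿distribʳ-* _ _ ⟩
    ⟦ i ⟧ℤ * - ⟦ j ⟧ℤ        ≈⟨ *-congˡ (-‿homo j) ⟨
    ⟦ i ⟧ℤ * ⟦ ℤ.- j ⟧ℤ      ∎

  *-homo : ∀ i j → ⟦ i ℤ.* j ⟧ℤ ≈ ⟦ i ⟧ℤ * ⟦ j ⟧ℤ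
  *-homo (+ m) (+ n) = *-homo-+ m n
  *-homo (+ m) -[1+ n ] = *-homo-negʳ (+ m) (+ suc n) (*-homo-+ m (suc n))
  *-homo -[1+ m ] (+ n) = *-homo-negˡ (+ suc m) (+ n) (*-homo-+ (suc m) n)
  *-homo -[1+ m ] -[1+ n ] =
    *-homo-negˡ (+ suc m) -[1+ n ] (*-homo-negʳ (+ suc m) (+ suc n) (*-homo-+ (suc m) (suc n)))

  ℤ⟶R : ℤ.+-*-rawRing -Raw-AlmostCommutative⟶ fromCommutativeRing R
  ℤ⟶R = record
    { ⟦_⟧ = ⟦_⟧ℤ ; +-homo = +-homo ; *-homo = *-homo ; -‿homo = -‿homo
    ; 0-homo = refl ; 1-homo = refl }

  open import Algebra.Solver.Ring ℤ.+-*-rawRing (fromCommutativeRing R) ℤ⟶R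
    (λ i j → Maybe.map (reflexive ∘ ≡.cong ⟦_⟧ℤ) (dec⇒weaklyDec ℤ._≟_ i j)) public

module LinearAlgebra {c ℓ : Level} (R : CommutativeRing c ℓ) where
  open CommutativeRing R
  open Projective R
  open IntegerCoefficientSolver R using (Polynomial; solve; _:=_; _:+_; _:-_; _:*_; :-_; con)

  infixl 6 _⊖_
  infixr 7 _⊙_

  _⊖_ : Vec3 → Vec3 → Vec3
  (x₁ , x₂ , x₃) ⊖ (y₁ , y₂ , y₃) = (x₁ - y₁ , x₂ - y₂ , x₃ - y₃)

  _⊙_ : Carrier → Vec3 → Vec3
  s ⊙ (x₁ , x₂ , x₃) = (s * x₁ , s * x₂ , s * x₃)

  dot : Vec3 → Vec3 → Carrier
  dot (l₁ , l₂ , l₃) (x₁ , x₂ , x₃) = l₁ * x₁ + l₂ * x₂ + l₃ * x₃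

  private module Syntax {n : ℕ} where
    V : Set
    V = Polynomial n × Polynomial n × Polynomial n

    infixl 6 _⊖ˢ_
    infixr 7 _⊙ˢ_

    _⊖ˢ_ : V → V → V
    (x₁ , x₂ , x₃) ⊖ˢ (y₁ , y₂ , y₃) = (x₁ :- y₁ , x₂ :- y₂ , x₃ :- y₃)

    _⊙ˢ_ : Polynomial n → V → V
    s ⊙ˢ (x₁ , x₂ , x₃) = (s :* x₁ , s :* x₂ , s :* x₃)

    dotˢ : V → V → Polynomial n
    dotˢ (l₁ , l₂ , l₃) (x₁ , x₂ , x₃) = l₁ :* x₁ :+ l₂ :* x₂ :+ l₃ :* x₃

    det3ˢ : V → V → V → Polynomial n
    det3ˢ (a₁ , a₂ , a₃) (b₁ , b₂ , b₃) (c₁ , c₂ , c₃) =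
      a₁ :* (b₂ :* c₃ :- b₃ :* c₂) :- a₂ :* (b₁ :* c₃ :- b₃ :* c₁) :+ a₃ :* (b₁ :* c₂ :- b₂ :* c₁)
  open Syntax

  dot-comm : ∀ x y → dot x y ≈ dot y x
  dot-comm (x₁ , x₂ , x₃) (y₁ , y₂ , y₃) =
    solve 6 (λ x₁ x₂ x₃ y₁ y₂ y₃ → dotˢ (x₁ , x₂ , x₃) (y₁ , y₂ , y₃) := dotˢ (y₁ , y₂ , y₃) (x₁ , x₂ , x₃))
      refl x₁ x₂ x₃ y₁ y₂ y₃

  dot-⊖ : ∀ l x y → dot l (x ⊖ y) ≈ dot l x - dot l y
  dot-⊖ (l₁ , l₂ , l₃) (x₁ , x₂ , x₃) (y₁ , y₂ , y₃) =
    solve 9 (λ l₁ l₂ l₃ x₁ x₂ x₃ y₁ y₂ y₃ →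
      let l = (l₁ , l₂ , l₃); x = (x₁ , x₂ , x₃); y = (y₁ , y₂ , y₃) in
      dotˢ l (x ⊖ˢ y) := dotˢ l x :- dotˢ l y)
      refl l₁ l₂ l₃ x₁ x₂ x₃ y₁ y₂ y₃

  dot-⊙ : ∀ l s x → dot l (s ⊙ x) ≈ s * dot l x
  dot-⊙ (l₁ , l₂ , l₃) s (x₁ , x₂ , x₃) =
    solve 7 (λ l₁ l₂ l₃ s x₁ x₂ x₃ →
      let l = (l₁ , l₂ , l₃); x = (x₁ , x₂ , x₃) in
      dotˢ l (s ⊙ˢ x) := s :* dotˢ l x)
      refl l₁ l₂ l₃ s x₁ x₂ x₃

  det3-⊙ : ∀ r s t x y z → det3 (r ⊙ x) (s ⊙ y) (t ⊙ z) ≈ (r * s * t) * det3 x y z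
  det3-⊙ r s t (x₁ , x₂ , x₃) (y₁ , y₂ , y₃) (z₁ , z₂ , z₃) =
    solve 12 (λ r s t x₁ x₂ x₃ y₁ y₂ y₃ z₁ z₂ z₃ →
      let x = (x₁ , x₂ , x₃); y = (y₁ , y₂ , y₃); z = (z₁ , z₂ , z₃) in
      det3ˢ (r ⊙ˢ x) (s ⊙ˢ y) (t ⊙ˢ z) := (r :* s :* t) :* det3ˢ x y z)
      refl r s t x₁ x₂ x₃ y₁ y₂ y₃ z₁ z₂ z₃

  det3-⊙ʳ : ∀ s t x y z → det3 x (s ⊙ y) (t ⊙ z) ≈ (s * t) * det3 x y z
  det3-⊙ʳ s t (x₁ , x₂ , x₃) (y₁ , y₂ , y₃) (z₁ , z₂ , z₃) =
    solve 11 (λ s t x₁ x₂ x₃ y₁ y₂ y₃ z₁ z₂ z₃ →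
      let x = (x₁ , x₂ , x₃); y = (y₁ , y₂ , y₃); z = (z₁ , z₂ , z₃) in
      det3ˢ x (s ⊙ˢ y) (t ⊙ˢ z) := (s :* t) :* det3ˢ x y z)
      refl s t x₁ x₂ x₃ y₁ y₂ y₃ z₁ z₂ z₃

  det3-swap₁₂ : ∀ x y z → det3 x y z ≈ - det3 y x z
  det3-swap₁₂ (x₁ , x₂ , x₃) (y₁ , y₂ , y₃) (z₁ , z₂ , z₃) =
    solve 9 (λ x₁ x₂ x₃ y₁ y₂ y₃ z₁ z₂ z₃ →
      let x = (x₁ , x₂ , x₃); y = (y₁ , y₂ , y₃); z = (z₁ , z₂ , z₃) in
      det3ˢ x y z := :- det3ˢ y x z)
      refl x₁ x₂ x₃ y₁ y₂ y₃ z₁ z₂ z₃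

  det3-⊖₃ : ∀ x y z w → det3 x y z - det3 x y w ≈ det3 x y (z ⊖ w)
  det3-⊖₃ (x₁ , x₂ , x₃) (y₁ , y₂ , y₃) (z₁ , z₂ , z₃) (w₁ , w₂ , w₃) =
    solve 12 (λ x₁ x₂ x₃ y₁ y₂ y₃ z₁ z₂ z₃ w₁ w₂ w₃ →
      let x = (x₁ , x₂ , x₃); y = (y₁ , y₂ , y₃); z = (z₁ , z₂ , z₃); w = (w₁ , w₂ , w₃) in
      det3ˢ x y z :- det3ˢ x y w := det3ˢ x y (z ⊖ˢ w))
      refl x₁ x₂ x₃ y₁ y₂ y₃ z₁ z₂ z₃ w₁ w₂ w₃

  det3-column-⊖ : ∀ x y z → det3 x (y ⊖ z) z ≈ det3 x y z
  det3-column-⊖ (x₁ , x₂ , x₃) (y₁ , y₂ , y₃) (z₁ , z₂ , z₃) =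
    solve 9 (λ x₁ x₂ x₃ y₁ y₂ y₃ z₁ z₂ z₃ →
      let x = (x₁ , x₂ , x₃); y = (y₁ , y₂ , y₃); z = (z₁ , z₂ , z₃) in
      det3ˢ x (y ⊖ˢ z) z := det3ˢ x y z)
      refl x₁ x₂ x₃ y₁ y₂ y₃ z₁ z₂ z₃

  det3-translate : ∀ x y z → det3 (y ⊖ x) (z ⊖ x) x ≈ det3 x y z
  det3-translate (x₁ , x₂ , x₃) (y₁ , y₂ , y₃) (z₁ , z₂ , z₃) =
    solve 9 (λ x₁ x₂ x₃ y₁ y₂ y₃ z₁ z₂ z₃ →
      let x = (x₁ , x₂ , x₃); y = (y₁ , y₂ , y₃); z = (z₁ , z₂ , z₃) in
      det3ˢ (y ⊖ˢ x) (z ⊖ˢ x) x := det3ˢ x y z)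
      refl x₁ x₂ x₃ y₁ y₂ y₃ z₁ z₂ z₃

  det3-combination : ∀ s t x y → det3 (s ⊙ x ⊖ t ⊙ y) x y ≈ 0#
  det3-combination s t (x₁ , x₂ , x₃) (y₁ , y₂ , y₃) =
    solve 8 (λ s t x₁ x₂ x₃ y₁ y₂ y₃ →
      let x = (x₁ , x₂ , x₃); y = (y₁ , y₂ , y₃) in
      det3ˢ (s ⊙ˢ x ⊖ˢ t ⊙ˢ y) x y := con (+ 0))
      refl s t x₁ x₂ x₃ y₁ y₂ y₃

  det3-cramer : ∀ u v w t l →
    det3 u v w * dot l t ≈ det3 t v w * dot l u + det3 u t w * dot l v + det3 u v t * dot l w
  det3-cramer (u₁ , u₂ , u₃) (v₁ , v₂ , v₃) (w₁ , w₂ , w₃) (t₁ , t₂ , t₃) (l₁ , l₂ , l₃) =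
    solve 15 (λ u₁ u₂ u₃ v₁ v₂ v₃ w₁ w₂ w₃ t₁ t₂ t₃ l₁ l₂ l₃ →
      let u = (u₁ , u₂ , u₃); v = (v₁ , v₂ , v₃); w = (w₁ , w₂ , w₃); t = (t₁ , t₂ , t₃); l = (l₁ , l₂ , l₃) in
      det3ˢ u v w :* dotˢ l t := det3ˢ t v w :* dotˢ l u :+ det3ˢ u t w :* dotˢ l v :+ det3ˢ u v t :* dotˢ l w)
      refl u₁ u₂ u₃ v₁ v₂ v₃ w₁ w₂ w₃ t₁ t₂ t₃ l₁ l₂ l₃

  det3-⊖-swap : ∀ a b e f N → det3 (a ⊖ b) (e ⊖ f) N ≈ det3 (b ⊖ a) (f ⊖ e) N
  det3-⊖-swap (a₁ , a₂ , a₃) (b₁ , b₂ , b₃) (e₁ , e₂ , e₃) (f₁ , f₂ , f₃) (n₁ , n₂ , n₃) =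
    solve 15 (λ a₁ a₂ a₃ b₁ b₂ b₃ e₁ e₂ e₃ f₁ f₂ f₃ n₁ n₂ n₃ →
      let a = (a₁ , a₂ , a₃); b = (b₁ , b₂ , b₃); e = (e₁ , e₂ , e₃); f = (f₁ , f₂ , f₃); N = (n₁ , n₂ , n₃) in
      det3ˢ (a ⊖ˢ b) (e ⊖ˢ f) N := det3ˢ (b ⊖ˢ a) (f ⊖ˢ e) N)
      refl a₁ a₂ a₃ b₁ b₂ b₃ e₁ e₂ e₃ f₁ f₂ f₃ n₁ n₂ n₃

  det3-⊖-expand : ∀ a x y e x′ y′ N → det3 (x ⊖ y) (x′ ⊖ y′) N ≈
    det3 (x ⊖ a) (x′ ⊖ e) N - det3 (x ⊖ a) (y′ ⊖ e) N - det3 (y ⊖ a) (x′ ⊖ e) N + det3 (y ⊖ a) (y′ ⊖ e) N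
  det3-⊖-expand (a₁ , a₂ , a₃) (x₁ , x₂ , x₃) (y₁ , y₂ , y₃) (e₁ , e₂ , e₃) (z₁ , z₂ , z₃) (w₁ , w₂ , w₃) (n₁ , n₂ , n₃) =
    solve 21 (λ a₁ a₂ a₃ x₁ x₂ x₃ y₁ y₂ y₃ e₁ e₂ e₃ z₁ z₂ z₃ w₁ w₂ w₃ n₁ n₂ n₃ →
      let a = (a₁ , a₂ , a₃); x = (x₁ , x₂ , x₃); y = (y₁ , y₂ , y₃); e = (e₁ , e₂ , e₃)
          x′ = (z₁ , z₂ , z₃); y′ = (w₁ , w₂ , w₃); N = (n₁ , n₂ , n₃) in
      det3ˢ (x ⊖ˢ y) (x′ ⊖ˢ y′) N :=
        det3ˢ (x ⊖ˢ a) (x′ ⊖ˢ e) N :- det3ˢ (x ⊖ˢ a) (y′ ⊖ˢ e) N :- det3ˢ (y ⊖ˢ a) (x′ ⊖ˢ e) N :+ det3ˢ (y ⊖ˢ a) (y′ ⊖ˢ e) N)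
      refl a₁ a₂ a₃ x₁ x₂ x₃ y₁ y₂ y₃ e₁ e₂ e₃ z₁ z₂ z₃ w₁ w₂ w₃ n₁ n₂ n₃

  det3-⊖-triangle : ∀ a b c d N →
    det3 (c ⊖ b) (d ⊖ b) N ≈ det3 (c ⊖ a) (d ⊖ a) N + det3 (b ⊖ a) (c ⊖ a) N - det3 (b ⊖ a) (d ⊖ a) N
  det3-⊖-triangle (a₁ , a₂ , a₃) (b₁ , b₂ , b₃) (c₁ , c₂ , c₃) (d₁ , d₂ , d₃) (n₁ , n₂ , n₃) =
    solve 15 (λ a₁ a₂ a₃ b₁ b₂ b₃ c₁ c₂ c₃ d₁ d₂ d₃ n₁ n₂ n₃ →
      let a = (a₁ , a₂ , a₃); b = (b₁ , b₂ , b₃); c = (c₁ , c₂ , c₃); d = (d₁ , d₂ , d₃); N = (n₁ , n₂ , n₃) in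
      det3ˢ (c ⊖ˢ b) (d ⊖ˢ b) N := det3ˢ (c ⊖ˢ a) (d ⊖ˢ a) N :+ det3ˢ (b ⊖ˢ a) (c ⊖ˢ a) N :- det3ˢ (b ⊖ˢ a) (d ⊖ˢ a) N)
      refl a₁ a₂ a₃ b₁ b₂ b₃ c₁ c₂ c₃ d₁ d₂ d₃ n₁ n₂ n₃

  det3-plücker : ∀ u v x y N →
    det3 u v N * det3 x y N + det3 u y N * det3 v x N ≈ det3 u x N * det3 v y N
  det3-plücker (u₁ , u₂ , u₃) (v₁ , v₂ , v₃) (x₁ , x₂ , x₃) (y₁ , y₂ , y₃) (n₁ , n₂ , n₃) =
    solve 15 (λ u₁ u₂ u₃ v₁ v₂ v₃ x₁ x₂ x₃ y₁ y₂ y₃ n₁ n₂ n₃ →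
      let u = (u₁ , u₂ , u₃); v = (v₁ , v₂ , v₃); x = (x₁ , x₂ , x₃); y = (y₁ , y₂ , y₃); N = (n₁ , n₂ , n₃) in
      det3ˢ u v N :* det3ˢ x y N :+ det3ˢ u y N :* det3ˢ v x N := det3ˢ u x N :* det3ˢ v y N)
      refl u₁ u₂ u₃ v₁ v₂ v₃ x₁ x₂ x₃ y₁ y₂ y₃ n₁ n₂ n₃

  -- The variable xy is det(x⃗, y⃗, N) for the difference vectors of parallel-by-dilation:
  -- b⃗ = b − a, c⃗ = c − a, d⃗ = d − a and e⃗ = f − e, g⃗ = g − e, h⃗ = h − e.
  dilation-identity : ∀ bc bd be bg bh cd ce cg ch de dg dh →
    bc * (cd + bc - bd) * dh ≈
        bc * (bc * dh + bh * cd - bd * ch) + cd * (bc * de + be * cd - bd * ce) + (- bd) * (bc * dg + bg * cd - bd * cg)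
      + (- (bc * cd) - cd * cd + cd * bd) * be + (bc * bd - bd * bd + cd * bd) * cg + (- (cd * bd)) * (be - bg - ce + cg)
      + (bc * cd) * (be - bh - de + dh) + (- (bc * bd)) * (cg - ch - dg + dh)
  dilation-identity = solve 12 (λ bc bd be bg bh cd ce cg ch de dg dh →
    bc :* (cd :+ bc :- bd) :* dh :=
        bc :* (bc :* dh :+ bh :* cd :- bd :* ch) :+ cd :* (bc :* de :+ be :* cd :- bd :* ce) :+ (:- bd) :* (bc :* dg :+ bg :* cd :- bd :* cg)
      :+ (:- (bc :* cd) :- cd :* cd :+ cd :* bd) :* be :+ (bc :* bd :- bd :* bd :+ cd :* bd) :* cg :+ (:- (cd :* bd)) :* (be :- bg :- ce :+ cg)
      :+ (bc :* cd) :* (be :- bh :- de :+ dh) :+ (:- (bc :* bd)) :* (cg :- ch :- dg :+ dh)) refl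

  dot-basis : ∀ x₁ x₂ x₃ → let x = (x₁ , x₂ , x₃) in
    dot (1# , 0# , 0#) x ≈ x₁ × dot (0# , 1# , 0#) x ≈ x₂ × dot (0# , 0# , 1#) x ≈ x₃
  dot-basis x₁ x₂ x₃ =
    solve 3 (λ x₁ x₂ x₃ → dotˢ (con (+ 1) , con (+ 0) , con (+ 0)) (x₁ , x₂ , x₃) := x₁) refl x₁ x₂ x₃ ,
    solve 3 (λ x₁ x₂ x₃ → dotˢ (con (+ 0) , con (+ 1) , con (+ 0)) (x₁ , x₂ , x₃) := x₂) refl x₁ x₂ x₃ ,
    solve 3 (λ x₁ x₂ x₃ → dotˢ (con (+ 0) , con (+ 0) , con (+ 1)) (x₁ , x₂ , x₃) := x₃) refl x₁ x₂ x₃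

module FiniteField {c ℓ : Level} (R : CommutativeRing c ℓ) {q : ℕ} (F : IsFiniteFieldOfOrder R q) where
  open CommutativeRing R
  open IsFiniteFieldOfOrder F
  open Projective R
  open LinearAlgebra R
  open import Algebra.Properties.Ring ring using (-0#≈0#; x≈y⇒x∙y⁻¹≈ε; x∙y⁻¹≈ε⇒x≈y)
  open import Relation.Binary.Reasoning.Setoid setoid

  infixl 6 _+₀_

  _+₀_ : ∀ {x y} → x ≈ 0# → y ≈ 0# → x + y ≈ 0#
  x≈0 +₀ y≈0 = trans (+-cong x≈0 y≈0) (+-identityʳ 0#)

  *-zeroˡ : ∀ {x y} → x ≈ 0# → x * y ≈ 0#
  *-zeroˡ {x} {y} x≈0 = trans (*-congʳ x≈0) (zeroˡ y)

  *-zeroʳ : ∀ {x y} → y ≈ 0# → x * y ≈ 0#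
  *-zeroʳ {x} {y} y≈0 = trans (*-congˡ y≈0) (zeroʳ x)

  -- Finiteness of the field is used only here, to decide equality with 0.
  ≈0? : ∀ x → Dec (x ≈ 0#)
  ≈0? x with enum-surj x | enum-surj 0#
  ... | i , i↦x | j , j↦0 with i Fin.≟ j
  ... | yes ≡.refl = yes (trans (sym i↦x) j↦0)
  ... | no i≢j = no (λ x≈0 → i≢j (enum-inj i j (trans i↦x (trans x≈0 (sym j↦0)))))

  x*y≈0⇒y≈0 : ∀ {x y} → x ≉ 0# → x * y ≈ 0# → y ≈ 0#
  x*y≈0⇒y≈0 {x} {y} x≉0 xy≈0 with inverse x x≉0
  ... | x⁻¹ , xx⁻¹≈1 = begin
    y                ≈⟨ *-identityˡ y ⟨
    1# * y           ≈⟨ *-congʳ (trans (sym xx⁻¹≈1) (*-comm x x⁻¹)) ⟩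
    (x⁻¹ * x) * y    ≈⟨ *-assoc x⁻¹ x y ⟩
    x⁻¹ * (x * y)    ≈⟨ *-zeroʳ xy≈0 ⟩
    0#               ∎

  x*y≈0⇒x≈0 : ∀ {x y} → y ≉ 0# → x * y ≈ 0# → x ≈ 0#
  x*y≈0⇒x≈0 y≉0 xy≈0 = x*y≈0⇒y≈0 y≉0 (trans (*-comm _ _) xy≈0)

  *-≉0 : ∀ {x y} → x ≉ 0# → y ≉ 0# → x * y ≉ 0#
  *-≉0 x≉0 y≉0 xy≈0 = y≉0 (x*y≈0⇒y≈0 x≉0 xy≈0)

  x*y≈1⇒y≉0 : ∀ {x y} → x * y ≈ 1# → y ≉ 0#
  x*y≈1⇒y≉0 {x} xy≈1 y≈0 = 0≉1 (trans (sym (*-zeroʳ {x} y≈0)) xy≈1)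

  dot-witness : ∀ {p} → ¬ IsZero3 p → Σ Vec3 (λ t → dot t p ≉ 0#)
  dot-witness {p₁ , p₂ , p₃} p≉0 with dot-basis p₁ p₂ p₃ | ≈0? p₁ | ≈0? p₂ | ≈0? p₃
  ... | e₁·p≈p₁ , _ , _ | no p₁≉0 | _ | _ = (1# , 0# , 0#) , p₁≉0 ∘ trans (sym e₁·p≈p₁)
  ... | _ , e₂·p≈p₂ , _ | yes _ | no p₂≉0 | _ = (0# , 1# , 0#) , p₂≉0 ∘ trans (sym e₂·p≈p₂)
  ... | _ , _ , e₃·p≈p₃ | yes _ | yes _ | no p₃≉0 = (0# , 0# , 1#) , p₃≉0 ∘ trans (sym e₃·p≈p₃)
  ... | _ | yes p₁≈0 | yes p₂≈0 | yes p₃≈0 = ⊥-elim (p≉0 (p₁≈0 , p₂≈0 , p₃≈0))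

  parallel-by-dilation : ∀ {a b c d e f g h N} →
    det3 (a ⊖ b) (e ⊖ f) N ≈ 0# → det3 (a ⊖ c) (e ⊖ g) N ≈ 0# → det3 (b ⊖ c) (f ⊖ g) N ≈ 0# →
    det3 (b ⊖ d) (f ⊖ h) N ≈ 0# → det3 (c ⊖ d) (g ⊖ h) N ≈ 0# →
    det3 (b ⊖ a) (c ⊖ a) N ≉ 0# → det3 (c ⊖ b) (d ⊖ b) N ≉ 0# →
    det3 (a ⊖ d) (e ⊖ h) N ≈ 0#
  parallel-by-dilation {a} {b} {c} {d} {e} {f} {g} {h} {N} ab∥ef ac∥eg bc∥fg bd∥fh cd∥gh abc≉0 bcd≉0 =
    trans (det3-⊖-swap a d e h N)
      (x*y≈0⇒y≈0 (*-≉0 abc≉0 bcd≉0′) (trans (dilation-identity _ _ _ _ _ _ _ _ _ _ _ _)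
        (*-zeroʳ (plücker (h ⊖ e)) +₀ *-zeroʳ (plücker (f ⊖ e)) +₀ *-zeroʳ (plücker (g ⊖ e))
        +₀ *-zeroʳ (trans (sym (det3-⊖-swap a b e f N)) ab∥ef)
        +₀ *-zeroʳ (trans (sym (det3-⊖-swap a c e g N)) ac∥eg)
        +₀ *-zeroʳ (trans (sym (det3-⊖-expand a b c e f g N)) bc∥fg)
        +₀ *-zeroʳ (trans (sym (det3-⊖-expand a b d e f h N)) bd∥fh)
        +₀ *-zeroʳ (trans (sym (det3-⊖-expand a c d e g h N)) cd∥gh))))
    where
    β γ δ : Vec3
    β = b ⊖ a
    γ = c ⊖ a
    δ = d ⊖ a

    bcd≉0′ : det3 γ δ N + det3 β γ N - det3 β δ N ≉ 0#
    bcd≉0′ = bcd≉0 ∘ trans (det3-⊖-triangle a b c d N)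

    plücker : ∀ x → det3 β γ N * det3 δ x N + det3 β x N * det3 γ δ N - det3 β δ N * det3 γ x N ≈ 0#
    plücker x = x≈y⇒x∙y⁻¹≈ε (det3-plücker β γ δ x N)

  module Affine (l : Vec3) (l≉0 : ¬ IsZero3 l) where

    Direction : Vec3 → Set ℓ
    Direction u = dot l u ≈ 0#

    AffinePoint : Vec3 → Set ℓ
    AffinePoint x = dot l x ≈ 1#

    ⊖-direction : ∀ {x y} → AffinePoint x → AffinePoint y → Direction (x ⊖ y)
    ⊖-direction {x} {y} x∈ y∈ = trans (dot-⊖ l x y) (x≈y⇒x∙y⁻¹≈ε (trans x∈ (sym y∈)))

    det3-directions : ∀ {u v w} → Direction u → Direction v → Direction w → det3 u v w ≈ 0#
    det3-directions {u} {v} {w} u∈ v∈ w∈ with dot-witness l≉0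
    ... | t , t·l≉0 = x*y≈0⇒x≈0 (t·l≉0 ∘ trans (dot-comm t l))
      (trans (det3-cramer u v w t l) (*-zeroʳ u∈ +₀ *-zeroʳ v∈ +₀ *-zeroʳ w∈))

    det3-base-change : ∀ {u v z w} → Direction u → Direction v → AffinePoint z → AffinePoint w →
      det3 u v z ≈ det3 u v w
    det3-base-change {u} {v} {z} {w} u∈ v∈ z∈ w∈ =
      x∙y⁻¹≈ε⇒x≈y _ _ (trans (det3-⊖₃ u v z w) (det3-directions u∈ v∈ (⊖-direction z∈ w∈)))

    det3-affine-triangle : ∀ {x y z N} → AffinePoint x → AffinePoint y → AffinePoint z → AffinePoint N →
      det3 (y ⊖ x) (z ⊖ x) N ≈ det3 x y z
    det3-affine-triangle {x} {y} {z} x∈ y∈ z∈ N∈ =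
      trans (det3-base-change (⊖-direction y∈ x∈) (⊖-direction z∈ x∈) N∈ x∈) (det3-translate x y z)

    concurrent⇒parallel : ∀ {p x y x′ y′ N} → ¬ IsZero3 p → Direction p →
      AffinePoint x → AffinePoint y → AffinePoint x′ → AffinePoint y′ → AffinePoint N →
      det3 p x y ≈ 0# → det3 p x′ y′ ≈ 0# → det3 (x ⊖ y) (x′ ⊖ y′) N ≈ 0#
    concurrent⇒parallel {p} {x} {y} {x′} {y′} {N} p≉0 p∈ x∈ y∈ x′∈ y′∈ N∈ pxy≈0 px′y′≈0
      with dot-witness p≉0
    ... | t , t·p≉0 = x*y≈0⇒x≈0 t·p≉0 (trans (det3-cramer (x ⊖ y) (x′ ⊖ y′) N p t)
      (*-zeroˡ (through x′∈ y′∈ px′y′≈0)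
        +₀ *-zeroˡ (trans (det3-swap₁₂ _ _ _) (trans (-‿cong (through x∈ y∈ pxy≈0)) -0#≈0#))
        +₀ *-zeroˡ (det3-directions (⊖-direction x∈ y∈) (⊖-direction x′∈ y′∈) p∈)))
      where
      through : ∀ {r s} → AffinePoint r → AffinePoint s → det3 p r s ≈ 0# → det3 p (r ⊖ s) N ≈ 0#
      through {r} {s} r∈ s∈ prs≈0 =
        trans (det3-base-change p∈ (⊖-direction r∈ s∈) N∈ s∈) (trans (det3-column-⊖ p r s) prs≈0)

    parallel⇒collinear : ∀ {x y x′ y′ N} → AffinePoint x → AffinePoint y → AffinePoint x′ → AffinePoint y′ →
      AffinePoint N → det3 (x ⊖ y) (x′ ⊖ y′) N ≈ 0# → det3 (x ⊖ y) x′ y′ ≈ 0#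
    parallel⇒collinear {x} {y} {x′} {y′} {N} x∈ y∈ x′∈ y′∈ N∈ xy∥x′y′ = begin
      det3 (x ⊖ y) x′ y′            ≈⟨ det3-column-⊖ (x ⊖ y) x′ y′ ⟨
      det3 (x ⊖ y) (x′ ⊖ y′) y′     ≈⟨ det3-base-change (⊖-direction x∈ y∈) (⊖-direction x′∈ y′∈) y′∈ N∈ ⟩
      det3 (x ⊖ y) (x′ ⊖ y′) N      ≈⟨ xy∥x′y′ ⟩
      0#                            ∎

  s*x-t*y≈0⇒x≈[w*t]*y : ∀ {w s t x y} → w * s ≈ 1# → s * x - t * y ≈ 0# → x ≈ (w * t) * y
  s*x-t*y≈0⇒x≈[w*t]*y {w} {s} {t} {x} {y} ws≈1 sx-ty≈0 = begin
    x              ≈⟨ *-identityˡ x ⟨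
    1# * x         ≈⟨ *-congʳ ws≈1 ⟨
    (w * s) * x    ≈⟨ *-assoc w s x ⟩
    w * (s * x)    ≈⟨ *-congˡ (x∙y⁻¹≈ε⇒x≈y _ _ sx-ty≈0) ⟩
    w * (t * y)    ≈⟨ *-assoc w t y ⟨
    (w * t) * y    ∎

module HyperfocusedArc {c ℓ : Level} (R : CommutativeRing c ℓ) {q : ℕ} (F : IsFiniteFieldOfOrder R q)
  {k : ℕ} {K : Fin k → Projective.Point R} {L : Projective.Line R}
  (HF : Projective.IsHyperfocused R k K L) where
  open CommutativeRing R
  open IsFiniteFieldOfOrder F using (inverse)
  open Projective R
  open IsHyperfocused HF using (arc; disjoint)
  open IsArc arc using (distinct; noThreeColl)
  open LinearAlgebra R
  open FiniteField R F

  l : Vec3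
  l = proj₁ L

  open Affine l (proj₂ L) public

  scale : Fin k → Carrier
  scale i = proj₁ (inverse (dot l (coords (K i))) (disjoint i))

  dot*scale≈1 : ∀ i → dot l (coords (K i)) * scale i ≈ 1#
  dot*scale≈1 i = proj₂ (inverse (dot l (coords (K i))) (disjoint i))

  scale≉0 : ∀ i → scale i ≉ 0#
  scale≉0 i = x*y≈1⇒y≉0 (dot*scale≈1 i)

  affine : Fin k → Vec3
  affine i = scale i ⊙ coords (K i)

  affine∈ : ∀ i → AffinePoint (affine i)
  affine∈ i = trans (dot-⊙ l (scale i) (coords (K i))) (trans (*-comm _ _) (dot*scale≈1 i))

  sameFactor⇒parallel : ∀ {i j i′ j′ N} → AffinePoint N → SameFactor k K L i j i′ j′ →
    det3 (affine i ⊖ affine j) (affine i′ ⊖ affine j′) N ≈ 0#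
  sameFactor⇒parallel {i} {j} {i′} {j′} N∈ (P , P∈L , P∈KiKj , P∈Ki′Kj′) =
    concurrent⇒parallel (proj₂ P) P∈L (affine∈ i) (affine∈ j) (affine∈ i′) (affine∈ j′) N∈
      (rescale P∈KiKj) (rescale P∈Ki′Kj′)
    where
    rescale : ∀ {m n} → det3 (coords P) (coords (K m)) (coords (K n)) ≈ 0# →
      det3 (coords P) (affine m) (affine n) ≈ 0#
    rescale {m} {n} PKmKn≈0 = trans (det3-⊙ʳ (scale m) (scale n) _ _ _) (*-zeroʳ PKmKn≈0)

  triangle≉0 : ∀ {i j m N} → i ≢ j → i ≢ m → j ≢ m → AffinePoint N →
    det3 (affine j ⊖ affine i) (affine m ⊖ affine i) N ≉ 0#
  triangle≉0 {i} {j} {m} i≢j i≢m j≢m N∈ ijm≈0 =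
    noThreeColl i j m i≢j i≢m j≢m (x*y≈0⇒y≈0 (*-≉0 (*-≉0 (scale≉0 i) (scale≉0 j)) (scale≉0 m))
      (trans (sym (det3-⊙ _ _ _ _ _ _))
        (trans (sym (det3-affine-triangle (affine∈ i) (affine∈ j) (affine∈ m) N∈)) ijm≈0)))

  parallel⇒sameFactor : ∀ {i j i′ j′ N} → i ≢ j → AffinePoint N →
    det3 (affine i ⊖ affine j) (affine i′ ⊖ affine j′) N ≈ 0# → SameFactor k K L i j i′ j′
  parallel⇒sameFactor {i} {j} {i′} {j′} i≢j N∈ ij∥i′j′ =
    (affine i ⊖ affine j , distinct i j i≢j ∘ samePoint) ,
    ⊖-direction (affine∈ i) (affine∈ j) ,
    det3-combination (scale i) (scale j) (coords (K i)) (coords (K j)) ,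
    x*y≈0⇒y≈0 (*-≉0 (scale≉0 i′) (scale≉0 j′))
      (trans (sym (det3-⊙ʳ _ _ _ _ _))
        (parallel⇒collinear (affine∈ i) (affine∈ j) (affine∈ i′) (affine∈ j′) N∈ ij∥i′j′))
    where
    samePoint : IsZero3 (affine i ⊖ affine j) → SamePoint (K i) (K j)
    samePoint (z₁ , z₂ , z₃) =
      dot l (coords (K i)) * scale j , *-≉0 (disjoint i) (scale≉0 j) ,
      s*x-t*y≈0⇒x≈[w*t]*y (dot*scale≈1 i) z₁ ,
      s*x-t*y≈0⇒x≈[w*t]*y (dot*scale≈1 i) z₂ ,
      s*x-t*y≈0⇒x≈[w*t]*y (dot*scale≈1 i) z₃

lemma2 : {c ℓ : Level} (R : CommutativeRing c ℓ) (h : ℕ) →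
    IsFiniteFieldOfOrder R (2 ^ h) →
    (k : ℕ) (K : Fin k → Projective.Point R) (L : Projective.Line R) →
    Projective.IsHyperfocused R k K L →
    (v : Fin 8 → Fin k) → Injective _≡_ _≡_ v →
    Projective.SameFactor R k K L (v (# 0)) (v (# 1)) (v (# 4)) (v (# 5)) →
    Projective.SameFactor R k K L (v (# 0)) (v (# 2)) (v (# 4)) (v (# 6)) →
    Projective.SameFactor R k K L (v (# 1)) (v (# 2)) (v (# 5)) (v (# 6)) →
    Projective.SameFactor R k K L (v (# 1)) (v (# 3)) (v (# 5)) (v (# 7)) →
    Projective.SameFactor R k K L (v (# 2)) (v (# 3)) (v (# 6)) (v (# 7)) →
    Projective.SameFactor R k K L (v (# 0)) (v (# 3)) (v (# 4)) (v (# 7))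
lemma2 R h F k K L HF v v-inj AB∥EF AC∥EG BC∥FG BD∥FH CD∥GH =
  parallel⇒sameFactor (distinct λ ()) N∈
    (parallel-by-dilation (parallel AB∥EF) (parallel AC∥EG) (parallel BC∥FG) (parallel BD∥FH) (parallel CD∥GH)
      (triangle≉0 (distinct λ ()) (distinct λ ()) (distinct λ ()) N∈)
      (triangle≉0 (distinct λ ()) (distinct λ ()) (distinct λ ()) N∈))
  where
  open CommutativeRing R using (_≈_; 0#)
  open Projective R using (SameFactor; det3)
  open LinearAlgebra R using (_⊖_)
  open FiniteField R F using (parallel-by-dilation)
  open HyperfocusedArc R F HF

  distinct : ∀ {m n : Fin 8} → m ≢ n → v m ≢ v n
  distinct m≢n = m≢n ∘ v-inj

  N∈ : AffinePoint (affine (v (# 0)))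
  N∈ = affine∈ (v (# 0))

  parallel : ∀ {i j i′ j′} → SameFactor k K L i j i′ j′ →
    det3 (affine i ⊖ affine j) (affine i′ ⊖ affine j′) (affine (v (# 0))) ≈ 0#
  parallel = sameFactor⇒parallel N∈
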